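{- Let $n,k$ be positive integers with $n\ge 2k$ and $\gcd(n,k)=1$, let $a,b$ be the smallest positive integers with $ak=bn-1$, and let $e$ be a cycle-edge of $Q(n,k)$. Then $Q(n,k)\setminus\{e\}$ (the graph obtained by deleting the edge $e$) is homomorphically equivalent to $Q(a,b)$, i.e. there are graph homomorphisms in both directions between them.
   Context: For a positive integer $n$ let $[n]=\{1,\dots,n\}$ and let $C_n$ be the cycle on $[n]$ with edges $\{i,i+1\}$ ($1\le i\le n-1$) and $\{n,1\}$. The Schrijver graph $\mathrm{SG}(n,k)$ ($n\ge 2k$) has as vertices the $k$-subsets of $[n]$ containing no two cyclically consecutive elements, two vertices adjacent iff they are disjoint. An arc of $C_n$ is a set $\{i,i+1,\dots,i+m-1\}$ (addition mod $n$) with $1\le m\le n-1$. A set $U\subseteq[n]$ is well-spread if for any two arcs $A,B$ with $|A|=|B|$ we have $\big||A\cap U|-|B\cap U|\big|\le 1$. $Q(n,k)$ is the induced subgraph of $\mathrm{SG}(n,k)$ on all well-spread $k$-subsets of $[n]$. Let $\rho:[n]\to[n]$ be the rotation $i\mapsto i+1$ (mod $n$), acting on subsets elementwise. An edge $XY$ of $Q(n,k)$ is a cycle-edge if $Y=\rho(X)$ or $X=\rho(Y)$. A homomorphism $G\to H$ is a map $V(G)\to V(H)$ sending edges to edges. -}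

module Defs where

open import Data.Nat using (ℕ; zero; suc; _+_; _≤_; _<_; _<?_; s≤s)
open import Data.Fin using (Fin; toℕ; fromℕ<) renaming (zero to fzero)
open import Data.Fin.Subset using (Subset; _∈_; ∣_∣; inside; outside)
open import Data.Vec using (lookup)
open import Data.Product using (Σ; _×_; proj₁)
open import Data.Sum using (_⊎_)
open import Relation.Nullary using (¬_; yes; no)
open import Relation.Binary.PropositionalEquality using (_≡_)

-- Vertex i of C_n is represented by (i-1 : Fin n).
-- Cyclic successor i ↦ i+1 (mod n) on Fin n.
next : ∀ {n} → Fin n → Fin n
next {suc n} i with suc (toℕ i) <? suc n
... | yes p = fromℕ< p
... | no _  = fzero

arcCount : ∀ {n} → Subset n → Fin n → ℕ → ℕ
arcCount U i zero    = 0
arcCount U i (suc m) with lookup U i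
... | inside  = suc (arcCount U (next i) m)
... | outside = arcCount U (next i) m

NoConsecutive : ∀ {n} → Subset n → Set
NoConsecutive X = ∀ i → i ∈ X → next i ∈ X → i ≡ next i

WellSpread : ∀ {n} → Subset n → Set
WellSpread {n} U = ∀ (m : ℕ) → 1 ≤ m → m + 1 ≤ n → ∀ (i j : Fin n) →
  arcCount U i m ≤ arcCount U j m + 1

Disjoint : ∀ {n} → Subset n → Subset n → Set
Disjoint X Y = ∀ i → i ∈ X → ¬ (i ∈ Y)

IsRotation : ∀ {n} → Subset n → Subset n → Set
IsRotation X Y = ∀ i → lookup Y (next i) ≡ lookup X i

record Graph : Set₁ where
  field
    V   : Set
    Adj : V → V → Set
open Graph public

Hom : Graph → Graph → Set
Hom G H = Σ (V G → V H) λ f → ∀ u v → Adj G u v → Adj H (f u) (f v)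

HomEquivalent : Graph → Graph → Set
HomEquivalent G H = Hom G H × Hom H G

QVertex : ℕ → ℕ → Set
QVertex n k = Σ (Subset n) λ X → (∣ X ∣ ≡ k) × NoConsecutive X × WellSpread X

Q : ℕ → ℕ → Graph
Q n k = record { V = QVertex n k ; Adj = λ X Y → Disjoint (proj₁ X) (proj₁ Y) }

IsCycleEdge : ∀ {n k} → QVertex n k → QVertex n k → Set
IsCycleEdge {n} {k} X Y =
  Adj (Q n k) X Y × (IsRotation (proj₁ X) (proj₁ Y) ⊎ IsRotation (proj₁ Y) (proj₁ X))

QMinusEdge : (n k : ℕ) → QVertex n k → QVertex n k → Graph
QMinusEdge n k X Y = record
  { V = QVertex n k
  ; Adj = λ U W → Adj (Q n k) U W ×
      ¬ ((proj₁ U ≡ proj₁ X × proj₁ W ≡ proj₁ Y) ⊎ (proj₁ U ≡ proj₁ Y × proj₁ W ≡ proj₁ X))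
  }

{-# OPTIONS --safe #-}
-- Identify [n] with ℤ_n and, for t ∈ ℕ, let S_t = {y : (y k + t) mod n ≥ n − k}, the set of
-- places where ⌊(y k + t)/n⌋ jumps. An arc of length m meets S_t in ⌊m k/n⌋ or ⌊m k/n⌋ + 1
-- points, so S_t is a vertex of Q(n,k). Conversely, averaging the arc counts of a well-spread
-- k-set U (and using n ∤ m k for 0 < m < n) forces its prefix counts to be ⌊(i k + t)/n⌋ for a
-- suitable t, so U = S_t. As k is invertible modulo n, S_t and S_s are disjoint exactly when
-- t − s mod n lies in [k, n − k]: Q(n,k) is a circular graph on the phases t mod n, and a
-- cycle-edge is a pair {t₀ + k, t₀}. Translating t₀ to 0, the map T ↦ ⌊T a/n⌋ sends every edge
-- except {k, 0} to an edge of Q(a,b) because b n = k a + 1, and x ↦ ⌈x n/a⌉ sends the edges of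
-- Q(a,b) to edges of Q(n,k) whose upper end lies strictly between k and n, hence never onto
-- the deleted edge.

module Submission where

open import Data.Bool using (Bool; true; false)
open import Data.Empty using (⊥-elim)
open import Data.Fin using (Fin; toℕ; fromℕ<) renaming (zero to fzero; suc to fsuc)
open import Data.Fin.Properties using (toℕ-injective; toℕ-fromℕ<; toℕ<n)
open import Data.Fin.Subset using (Subset; ∣_∣; _∈_)
open import Data.List using (upTo)
open import Data.List.Membership.Propositional.Properties using (∈-upTo⁺; ∈-upTo⁻)
open import Data.List.Relation.Unary.All as All using (All)
open import Data.Nat
open import Data.Nat.DivMod
open import Data.Nat.Divisibility using (divides-refl)
open import Data.Nat.GCD using (gcd)
open import Data.Nat.Properties
open import Data.List.Extrema ≤-totalOrder using (argmax; f[xs]≤f[argmax]; argmax-all)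
open import Data.Nat.Tactic.RingSolver using (solve-∀)
open import Data.Product using (Σ; _×_; _,_; proj₁; proj₂; uncurry)
open import Data.Sum using (_⊎_; inj₁; inj₂) renaming (swap to ⊎-swap)
open import Data.Vec using (Vec; []; _∷_; lookup; tabulate)
open import Data.Vec.Properties using (lookup∘tabulate; tabulate∘lookup; tabulate-cong; []=⇒lookup; lookup⇒[]=)
open import Function using (id; _∘_)
open import Relation.Binary.Definitions using (tri<; tri≈; tri>)
open import Relation.Binary.PropositionalEquality
open import Relation.Nullary using (¬_; Dec; yes; no; does)
open import Relation.Nullary.Decidable using (dec-true; dec-false)

open import Defs

-- Floor and remainder arithmetic

bit : Bool → ℕ
bit true  = 1
bit false = 0

bit-injective : ∀ {b c} → bit b ≡ bit c → b ≡ c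
bit-injective {true}  {true}  _ = refl
bit-injective {false} {false} _ = refl

does≡true⇒ : ∀ {A : Set} (a? : Dec A) → does a? ≡ true → A
does≡true⇒ (yes a) _ = a

module _ {N : ℕ} .{{_ : NonZero N}} where

  /-unique : ∀ {q X} → q * N ≤ X → X < q * N + N → X / N ≡ q
  /-unique {q} {X} q*N≤X X<q*N+N = ≤-antisym
    (≤-pred (m<n*o⇒m/o<n (subst (X <_) (+-comm (q * N) N) X<q*N+N)))
    (subst (_≤ X / N) (m*n/n≡m q N) (/-monoˡ-≤ N q*N≤X))

  %-unique : ∀ {q r X} → r < N → X ≡ r + q * N → X % N ≡ r
  %-unique {q} {r} r<N refl = trans ([m+kn]%n≡m%n r q N) (m<n⇒m%n≡m r<N)

  ≤-/ : ∀ {q X} → q * N ≤ X → q ≤ X / N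
  ≤-/ {q} le = subst (_≤ _) (m*n/n≡m q N) (/-monoˡ-≤ N le)

  [m+kn]/n≡m/n+k : ∀ X q → (X + q * N) / N ≡ X / N + q
  [m+kn]/n≡m/n+k X q = trans (+-distrib-/-∣ʳ X (divides-refl q)) (cong (X / N +_) (m*n/n≡m q N))

  /-split : ∀ X D → (X + D) / N ≡ X / N + (X % N + D) / N
  /-split X D = begin
      (X + D) / N                          ≡⟨ cong (λ z → (z + D) / N) (m≡m%n+[m/n]*n X N) ⟩
      (X % N + X / N * N + D) / N          ≡⟨ cong (_/ N) (swap (X % N) (X / N * N) D) ⟩
      (X % N + D + X / N * N) / N          ≡⟨ [m+kn]/n≡m/n+k (X % N + D) (X / N) ⟩
      (X % N + D) / N + X / N              ≡⟨ +-comm _ (X / N) ⟩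
      X / N + (X % N + D) / N              ∎
    where open ≡-Reasoning
          swap : ∀ a b c → a + b + c ≡ a + c + b
          swap = solve-∀

  [r+D]/N-bounds : ∀ {r} D → r < N → D / N ≤ (r + D) / N × (r + D) / N ≤ D / N + 1
  [r+D]/N-bounds {r} D r<N =
      /-monoˡ-≤ N (m≤n+m D r)
    , (begin
      (r + D) / N        ≤⟨ /-monoˡ-≤ N (+-monoˡ-≤ D (<⇒≤ r<N)) ⟩
      (N + D) / N        ≡⟨ cong (_/ N) (trans (+-comm N D) (cong (D +_) (sym (*-identityˡ N)))) ⟩
      (D + 1 * N) / N    ≡⟨ [m+kn]/n≡m/n+k D 1 ⟩
      D / N + 1          ∎)
    where open ≤-Reasoning

  %-+-absorbˡ : ∀ X D → (X % N + D) % N ≡ (X + D) % N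
  %-+-absorbˡ X D = begin
      (X % N + D) % N                  ≡⟨ [m+kn]%n≡m%n (X % N + D) (X / N) N ⟨
      (X % N + D + X / N * N) % N      ≡⟨ cong (_% N) (swap (X % N) D (X / N * N)) ⟩
      (X % N + X / N * N + D) % N      ≡⟨ cong (λ z → (z + D) % N) (m≡m%n+[m/n]*n X N) ⟨
      (X + D) % N                      ∎
    where open ≡-Reasoning
          swap : ∀ a b c → a + b + c ≡ a + c + b
          swap = solve-∀

  %-+-cancelʳ : ∀ {x y} c → x < N → y < N → (x + c) % N ≡ (y + c) % N → x ≡ y
  %-+-cancelʳ {x} {y} c x<N y<N eq = begin
      x                                ≡⟨ undo x<N ⟨
      ((x + c) % N + (N ∸ c % N)) % N  ≡⟨ cong (λ z → (z + (N ∸ c % N)) % N) eq ⟩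
      ((y + c) % N + (N ∸ c % N)) % N  ≡⟨ undo y<N ⟩
      y                                ∎
    where
      open ≡-Reasoning
      undo : ∀ {z} → z < N → ((z + c) % N + (N ∸ c % N)) % N ≡ z
      undo {z} z<N = trans (%-+-absorbˡ (z + c) (N ∸ c % N)) (%-unique {q = c / N + 1} z<N (begin
        z + c + (N ∸ c % N)                           ≡⟨ cong (λ w → z + w + (N ∸ c % N)) (m≡m%n+[m/n]*n c N) ⟩
        z + (c % N + c / N * N) + (N ∸ c % N)         ≡⟨ shuffle z (c % N) (c / N * N) (N ∸ c % N) ⟩
        z + (c % N + (N ∸ c % N)) + c / N * N         ≡⟨ cong (λ w → z + w + c / N * N) (m+[n∸m]≡n (m%n≤n c N)) ⟩
        z + N + c / N * N                             ≡⟨ collect z N (c / N) ⟩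
        z + (c / N + 1) * N                           ∎))
        where shuffle : ∀ a b c d → a + (b + c) + d ≡ a + (b + d) + c
              shuffle = solve-∀
              collect : ∀ z n q → z + n + q * n ≡ z + (q + 1) * n
              collect = solve-∀

  [r+K]/N≡bit : ∀ {r K} → r < N → K ≤ N → (r + K) / N ≡ bit (does (N ≤? r + K))
  [r+K]/N≡bit {r} {K} r<N K≤N with N ≤? r + K
  ... | yes N≤r+K rewrite dec-true (N ≤? r + K) N≤r+K = /-unique (subst (_≤ r + K) (sym (+-identityʳ N)) N≤r+K)
                             (subst (r + K <_) (cong (_+ N) (sym (+-identityʳ N))) (+-mono-<-≤ r<N K≤N))
  ... | no  N≰r+K rewrite dec-false (N ≤? r + K) N≰r+K = m<n⇒m/n≡0 (≰⇒> N≰r+K)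

  top+D-not-top : ∀ {K r D} → r < N → K ≤ D → D + K ≤ N → N ≤ r + K → (r + D) % N + K < N
  top+D-not-top {K} {r} {D} r<N K≤D D+K≤N N≤r+K = subst (λ x → x + K < N) (sym r+D%N≡z) z+K<N
    where
      open ≤-Reasoning
      z : ℕ
      z = r + D ∸ N
      z+N≡r+D : z + N ≡ r + D
      z+N≡r+D = m∸n+n≡m (≤-trans N≤r+K (+-monoʳ-≤ r K≤D))
      z+K<N : z + K < N
      z+K<N = +-cancelʳ-< N (z + K) N (begin-strict
        z + K + N        ≡⟨ trans (+-assoc z K N) (trans (cong (z +_) (+-comm K N)) (sym (+-assoc z N K))) ⟩
        z + N + K        ≡⟨ cong (_+ K) z+N≡r+D ⟩
        r + D + K        ≡⟨ +-assoc r D K ⟩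
        r + (D + K)      ≤⟨ +-monoʳ-≤ r D+K≤N ⟩
        r + N            <⟨ +-monoˡ-< N r<N ⟩
        N + N            ∎)
      r+D%N≡z : (r + D) % N ≡ z
      r+D%N≡z = %-unique {q = 1} (≤-<-trans (m≤m+n z K) z+K<N) (trans (sym z+N≡r+D) (cong (z +_) (sym (+-identityʳ N))))

  /-gap : ∀ X Y q → q * N ≤ X % N + Y → X / N + q ≤ (X + Y) / N
  /-gap X Y q q*N≤ = subst (X / N + q ≤_) (sym (/-split X Y)) (+-monoʳ-≤ (X / N) (≤-/ q*N≤))

*-invertible⇒≢ : ∀ {N K e f} .{{_ : NonZero N}} → e * K ≡ f * N + 1 →
                 ∀ m → 0 < m → m < N → ∀ q → m * K ≢ q * N
*-invertible⇒≢ {N} {K} {e} {f} inverse m 0<m m<N q mK≡qN = <⇒≢ 0<m (sym (begin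
    m                            ≡⟨ m<n⇒m%n≡m m<N ⟨
    m % N                        ≡⟨ [m+kn]%n≡m%n m (m * f) N ⟨
    (m + m * f * N) % N          ≡⟨ cong (_% N) (begin
        m + m * f * N                ≡⟨ regroup m f N ⟩
        m * (f * N + 1)              ≡⟨ cong (m *_) inverse ⟨
        m * (e * K)                  ≡⟨ swap m e K ⟩
        e * (m * K)                  ≡⟨ cong (e *_) mK≡qN ⟩
        e * (q * N)                  ≡⟨ *-assoc e q N ⟨
        e * q * N                    ∎) ⟩
    (e * q * N) % N              ≡⟨ m*n%n≡0 (e * q) N ⟩
    0                            ∎))
  where
    open ≡-Reasoning
    regroup : ∀ m f n → m + m * f * n ≡ m * (f * n + 1)
    regroup = solve-∀
    swap : ∀ m e k → m * (e * k) ≡ e * (m * k)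
    swap = solve-∀

-- Finite sums and maxima

∑ : ℕ → (ℕ → ℕ) → ℕ
∑ zero    f = 0
∑ (suc m) f = f 0 + ∑ m (λ j → f (suc j))

∑-cong : ∀ m {f g : ℕ → ℕ} → (∀ j → j < m → f j ≡ g j) → ∑ m f ≡ ∑ m g
∑-cong zero    f≗g = refl
∑-cong (suc m) f≗g = cong₂ _+_ (f≗g 0 z<s) (∑-cong m (λ j j<m → f≗g (suc j) (s<s j<m)))

∑-split : ∀ x m f → ∑ (x + m) f ≡ ∑ x f + ∑ m (λ j → f (x + j))
∑-split zero    m f = refl
∑-split (suc x) m f = trans (cong (f 0 +_) (∑-split x m (λ j → f (suc j)))) (sym (+-assoc (f 0) _ _))

∑-snoc : ∀ m f → ∑ (suc m) f ≡ ∑ m f + f m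
∑-snoc m f = begin
    ∑ (suc m) f                        ≡⟨ cong (λ k → ∑ k f) (+-comm 1 m) ⟩
    ∑ (m + 1) f                        ≡⟨ ∑-split m 1 f ⟩
    ∑ m f + (f (m + 0) + 0)            ≡⟨ cong (λ z → ∑ m f + z) (trans (+-identityʳ _) (cong f (+-identityʳ m))) ⟩
    ∑ m f + f m                        ∎
  where open ≡-Reasoning

∑-distrib-+ : ∀ m f g → ∑ m (λ j → f j + g j) ≡ ∑ m f + ∑ m g
∑-distrib-+ zero    f g = refl
∑-distrib-+ (suc m) f g = trans (cong (f 0 + g 0 +_) (∑-distrib-+ m (λ j → f (suc j)) (λ j → g (suc j))))
  (interchange (f 0) (g 0) _ _)
  where interchange : ∀ a b c d → (a + b) + (c + d) ≡ (a + c) + (b + d)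
        interchange = solve-∀

∑-const : ∀ m c → ∑ m (λ _ → c) ≡ m * c
∑-const zero    c = refl
∑-const (suc m) c = cong (c +_) (∑-const m c)

∑-mono-≤ : ∀ m {f g : ℕ → ℕ} → (∀ j → f j ≤ g j) → ∑ m f ≤ ∑ m g
∑-mono-≤ zero    f≤g = z≤n
∑-mono-≤ (suc m) f≤g = +-mono-≤ (f≤g 0) (∑-mono-≤ m (λ j → f≤g (suc j)))

∑-swap : ∀ m l (h : ℕ → ℕ → ℕ) → ∑ m (λ x → ∑ l (h x)) ≡ ∑ l (λ j → ∑ m (λ x → h x j))
∑-swap m zero    h = trans (∑-const m 0) (*-zeroʳ m)
∑-swap m (suc l) h = trans (∑-distrib-+ m (λ x → h x 0) (λ x → ∑ l (λ j → h x (suc j))))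
  (cong (∑ m (λ x → h x 0) +_) (∑-swap m l (λ x j → h x (suc j))))

module _ {N : ℕ} {f : ℕ → ℕ} (periodic : ∀ y → f (y + N) ≡ f y) where

  ∑-rotate : ∀ j → ∑ N (λ y → f (y + j)) ≡ ∑ N f
  ∑-rotate zero    = ∑-cong N (λ y _ → cong f (+-identityʳ y))
  ∑-rotate (suc j) = begin
      ∑ N (λ y → f (y + suc j))            ≡⟨ ∑-cong N (λ y _ → cong f (+-suc y j)) ⟩
      ∑ N (λ y → f (suc y + j))            ≡⟨ +-cancelˡ-≡ (f j) _ _ step ⟩
      ∑ N (λ y → f (y + j))                ≡⟨ ∑-rotate j ⟩
      ∑ N f                                ∎
    where
      open ≡-Reasoning
      step : f j + ∑ N (λ y → f (suc y + j)) ≡ f j + ∑ N (λ y → f (y + j))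
      step = begin
        ∑ (suc N) (λ y → f (y + j))             ≡⟨ ∑-snoc N (λ y → f (y + j)) ⟩
        ∑ N (λ y → f (y + j)) + f (N + j)       ≡⟨ cong (λ z → ∑ N (λ y → f (y + j)) + f z) (+-comm N j) ⟩
        ∑ N (λ y → f (y + j)) + f (j + N)       ≡⟨ cong (∑ N (λ y → f (y + j)) +_) (periodic j) ⟩
        ∑ N (λ y → f (y + j)) + f j             ≡⟨ +-comm _ (f j) ⟩
        f j + ∑ N (λ y → f (y + j))             ∎

module _ {f g : ℕ → ℕ} (step : ∀ y → f y + g y ≡ g (suc y)) where

  ∑-telescope : ∀ m x → ∑ m (λ j → f (x + j)) + g x ≡ g (x + m)
  ∑-telescope zero    x = cong g (sym (+-identityʳ x))
  ∑-telescope (suc m) x = begin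
      f (x + 0) + ∑ m (λ j → f (x + suc j)) + g x      ≡⟨ cong₂ (λ y s → f y + s + g x) (+-identityʳ x) (∑-cong m (λ j _ → cong f (+-suc x j))) ⟩
      f x + ∑ m (λ j → f (suc x + j)) + g x            ≡⟨ rearrange (f x) _ (g x) ⟩
      ∑ m (λ j → f (suc x + j)) + (f x + g x)          ≡⟨ cong (∑ m (λ j → f (suc x + j)) +_) (step x) ⟩
      ∑ m (λ j → f (suc x + j)) + g (suc x)            ≡⟨ ∑-telescope m (suc x) ⟩
      g (suc x + m)                                    ≡⟨ cong g (+-suc x m) ⟨
      g (x + suc m)                                    ∎
    where open ≡-Reasoning
          rearrange : ∀ a b c → a + b + c ≡ b + (a + c)
          rearrange = solve-∀

module _ (m : ℕ) {f : ℕ → ℕ} (spread : ∀ x z → f x ≤ f z + 1) where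

  ∑-spread-upper : ∀ x → m * f x ≤ ∑ m f + m
  ∑-spread-upper x = begin
      m * f x                     ≡⟨ ∑-const m (f x) ⟨
      ∑ m (λ _ → f x)             ≤⟨ ∑-mono-≤ m (spread x) ⟩
      ∑ m (λ z → f z + 1)         ≡⟨ ∑-distrib-+ m f (λ _ → 1) ⟩
      ∑ m f + ∑ m (λ _ → 1)       ≡⟨ cong (∑ m f +_) (trans (∑-const m 1) (*-identityʳ m)) ⟩
      ∑ m f + m                   ∎
    where open ≤-Reasoning

  ∑-spread-lower : ∀ x → ∑ m f ≤ m * f x + m
  ∑-spread-lower x = begin
      ∑ m f                       ≤⟨ ∑-mono-≤ m (λ z → spread z x) ⟩
      ∑ m (λ _ → f x + 1)         ≡⟨ ∑-const m (f x + 1) ⟩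
      m * (f x + 1)               ≡⟨ trans (*-distribˡ-+ m (f x) 1) (cong (m * f x +_) (*-identityʳ m)) ⟩
      m * f x + m                 ∎
    where open ≤-Reasoning

module _ (g : ℕ → ℕ) (M : ℕ) where

  -- opaque: conversion checking would otherwise unfold the argmax fold, which is prohibitively slow
  opaque

    max< : ℕ
    max< = g (argmax g 0 (upTo M))

    ≤-max< : ∀ {i} → i < M → g i ≤ max<
    ≤-max< i<M = All.lookup (f[xs]≤f[argmax] 0 (upTo M)) (∈-upTo⁺ i<M)

    max<-attained : ∀ (P : ℕ → Set) → P (g 0) → (∀ {i} → i < M → P (g i)) → P max<
    max<-attained P P0 Pi = argmax-all g {P = λ j → P (g j)} P0 (All.tabulate (λ j∈ → Pi (∈-upTo⁻ j∈)))

-- The cycle ℤ_N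

lookup-ext : ∀ {A : Set} {m} {xs ys : Vec A m} → (∀ i → lookup xs i ≡ lookup ys i) → xs ≡ ys
lookup-ext {xs = xs} {ys} eq = trans (sym (tabulate∘lookup xs)) (trans (tabulate-cong eq) (tabulate∘lookup ys))

toℕ-next : ∀ {n} (i : Fin (suc n)) → toℕ (next i) ≡ suc (toℕ i) % suc n
toℕ-next {n} i with suc (toℕ i) <? suc n
... | yes i+1<n = trans (toℕ-fromℕ< i+1<n) (sym (m<n⇒m%n≡m i+1<n))
... | no  i+1≮n = sym (trans (cong (_% suc n) (≤-antisym (toℕ<n i) (≮⇒≥ i+1≮n))) (n%n≡0 (suc n)))

∣∣≡∑ : ∀ {m} (v : Vec Bool m) (g : ℕ → ℕ) → (∀ i → g (toℕ i) ≡ bit (lookup v i)) → ∣ v ∣ ≡ ∑ m g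
∣∣≡∑ []          g g≗v = refl
∣∣≡∑ (true  ∷ v) g g≗v = cong₂ _+_ (sym (g≗v fzero)) (∣∣≡∑ v (λ j → g (suc j)) (λ i → g≗v (fsuc i)))
∣∣≡∑ (false ∷ v) g g≗v = cong₂ _+_ (sym (g≗v fzero)) (∣∣≡∑ v (λ j → g (suc j)) (λ i → g≗v (fsuc i)))

module Cycle (n′ : ℕ) where

  N : ℕ
  N = suc n′

  toℕ-mod : ∀ y → toℕ (y mod N) ≡ y % N
  toℕ-mod y = toℕ-fromℕ< (m%n<n y N)

  toℕ-mod-id : ∀ (i : Fin N) → toℕ i mod N ≡ i
  toℕ-mod-id i = toℕ-injective (trans (toℕ-mod (toℕ i)) (m<n⇒m%n≡m (toℕ<n i)))

  mod-cong : ∀ {y z} → y % N ≡ z % N → y mod N ≡ z mod N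
  mod-cong {y} {z} eq = toℕ-injective (trans (toℕ-mod y) (trans eq (sym (toℕ-mod z))))

  next-mod : ∀ y → next (y mod N) ≡ suc y mod N
  next-mod y = toℕ-injective (begin
      toℕ (next (y mod N))       ≡⟨ toℕ-next (y mod N) ⟩
      suc (toℕ (y mod N)) % N    ≡⟨ cong (λ z → suc z % N) (toℕ-mod y) ⟩
      (1 + y % N) % N            ≡⟨ cong (_% N) (+-comm 1 (y % N)) ⟩
      (y % N + 1) % N            ≡⟨ %-+-absorbˡ y 1 ⟩
      (y + 1) % N                ≡⟨ cong (_% N) (+-comm y 1) ⟩
      suc y % N                  ≡⟨ toℕ-mod (suc y) ⟨
      toℕ (suc y mod N)          ∎)
    where open ≡-Reasoning

  χ : Subset N → ℕ → ℕ
  χ U y = bit (lookup U (y mod N))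

  χ-periodic : ∀ U y → χ U (y + N) ≡ χ U y
  χ-periodic U y = cong (λ i → bit (lookup U i)) (mod-cong {y + N} {y} ([m+n]%n≡m%n y N))

  ∣∣≡∑χ : ∀ U → ∣ U ∣ ≡ ∑ N (χ U)
  ∣∣≡∑χ U = ∣∣≡∑ U (χ U) (λ i → cong (λ j → bit (lookup U j)) (toℕ-mod-id i))

  arcCount-suc : ∀ U (i : Fin N) m → arcCount U i (suc m) ≡ bit (lookup U i) + arcCount U (next i) m
  arcCount-suc U i m with lookup U i
  ... | true  = refl
  ... | false = refl

  arcCount≡∑ : ∀ U m x → arcCount U (x mod N) m ≡ ∑ m (λ j → χ U (x + j))
  arcCount≡∑ U zero    x = refl
  arcCount≡∑ U (suc m) x = begin
      arcCount U (x mod N) (suc m)                           ≡⟨ arcCount-suc U (x mod N) m ⟩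
      χ U x + arcCount U (next (x mod N)) m                  ≡⟨ cong (λ i → χ U x + arcCount U i m) (next-mod x) ⟩
      χ U x + arcCount U (suc x mod N) m                     ≡⟨ cong (χ U x +_) (arcCount≡∑ U m (suc x)) ⟩
      χ U x + ∑ m (λ j → χ U (suc x + j))                    ≡⟨ cong₂ _+_ (cong (χ U) (+-identityʳ x)) (∑-cong m (λ j _ → cong (χ U) (+-suc x j))) ⟨
      χ U (x + 0) + ∑ m (λ j → χ U (x + suc j))              ∎
    where open ≡-Reasoning

-- The sets S_t and their disjointness

Far : ℕ → ℕ → ℕ → ℕ → Set
Far N K t s = Σ ℕ λ D → t ≡ s + D × K ≤ D × D + K ≤ N

Disjoint-sym : ∀ {n} {X Y : Subset n} → Disjoint X Y → Disjoint Y X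
Disjoint-sym X∩Y=∅ i i∈Y i∈X = X∩Y=∅ i i∈X i∈Y

Far⇒+≤ : ∀ {N K t s} → Far N K t s → s + K ≤ t
Far⇒+≤ {s = s} (D , refl , K≤D , _) = +-monoʳ-≤ s K≤D

Far-intro : ∀ {N K t s} → s + K ≤ t → t + K ≤ s + N → Far N K t s
Far-intro {N} {K} {t} {s} s+K≤t t+K≤s+N = t ∸ s , sym s+[t∸s]≡t , K≤t∸s , t∸s+K≤N
  where
    s+[t∸s]≡t : s + (t ∸ s) ≡ t
    s+[t∸s]≡t = m+[n∸m]≡n (≤-trans (m≤m+n s K) s+K≤t)
    K≤t∸s : K ≤ t ∸ s
    K≤t∸s = subst (_≤ t ∸ s) (m+n∸m≡n s K) (∸-monoˡ-≤ s s+K≤t)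
    t∸s+K≤N : t ∸ s + K ≤ N
    t∸s+K≤N = +-cancelˡ-≤ s _ _ (subst (_≤ s + N) (trans (cong (_+ K) (sym s+[t∸s]≡t)) (+-assoc s (t ∸ s) K)) t+K≤s+N)

Far-complement : ∀ {N K t s} → Far N K t s → Far N K (s + N) t
Far-complement {N} {K} {s = s} (D , refl , K≤D , D+K≤N) = N ∸ D , s+N≡s+D+[N∸D] , K≤N∸D , N∸D+K≤N
  where
    D≤N : D ≤ N
    D≤N = ≤-trans (m≤m+n D K) D+K≤N
    s+N≡s+D+[N∸D] : s + N ≡ s + D + (N ∸ D)
    s+N≡s+D+[N∸D] = trans (cong (s +_) (sym (m+[n∸m]≡n D≤N))) (sym (+-assoc s D (N ∸ D)))
    K≤N∸D : K ≤ N ∸ D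
    K≤N∸D = subst (_≤ N ∸ D) (m+n∸m≡n D K) (∸-monoˡ-≤ D D+K≤N)
    N∸D+K≤N : N ∸ D + K ≤ N
    N∸D+K≤N = subst (N ∸ D + K ≤_) (m∸n+n≡m D≤N) (+-monoʳ-≤ (N ∸ D) K≤D)

module StandardSets (n′ K : ℕ) where

  open Cycle n′ public

  residue : ℕ → ℕ → ℕ
  residue t y = (y * K + t) % N

  InS : ℕ → ℕ → Set
  InS t y = N ≤ residue t y + K

  memb : ℕ → ℕ → Bool
  memb t y = does (N ≤? residue t y + K)

  S : ℕ → Subset N
  S t = tabulate (λ i → memb t (toℕ i))

  residue-%ʳ : ∀ t y → residue t (y % N) ≡ residue t y
  residue-%ʳ t y = begin
      (y % N * K + t) % N                       ≡⟨ [m+kn]%n≡m%n (y % N * K + t) (y / N * K) N ⟨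
      (y % N * K + t + y / N * K * N) % N       ≡⟨ cong (_% N) (regroup (y % N) (y / N) N K t) ⟩
      ((y % N + y / N * N) * K + t) % N         ≡⟨ cong (λ z → (z * K + t) % N) (m≡m%n+[m/n]*n y N) ⟨
      (y * K + t) % N                           ∎
    where open ≡-Reasoning
          regroup : ∀ r q n k t → r * k + t + q * k * n ≡ (r + q * n) * k + t
          regroup = solve-∀

  residue-%ˡ : ∀ t y → residue (t % N) y ≡ residue t y
  residue-%ˡ t y = begin
      (y * K + t % N) % N     ≡⟨ cong (_% N) (+-comm (y * K) (t % N)) ⟩
      (t % N + y * K) % N     ≡⟨ %-+-absorbˡ t (y * K) ⟩
      (t + y * K) % N         ≡⟨ cong (_% N) (+-comm t (y * K)) ⟩
      (y * K + t) % N         ∎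
    where open ≡-Reasoning

  residue-+ : ∀ t D y → residue (t + D) y ≡ (residue t y + D) % N
  residue-+ t D y = trans (cong (_% N) (sym (+-assoc (y * K) t D))) (sym (%-+-absorbˡ (y * K + t) D))

  lookup-S : ∀ t y → lookup (S t) (y mod N) ≡ memb t y
  lookup-S t y = begin
      lookup (S t) (y mod N)          ≡⟨ lookup∘tabulate (λ i → memb t (toℕ i)) (y mod N) ⟩
      memb t (toℕ (y mod N))          ≡⟨ cong (memb t) (toℕ-mod y) ⟩
      memb t (y % N)                  ≡⟨ cong (λ r → does (N ≤? r + K)) (residue-%ʳ t y) ⟩
      memb t y                        ∎
    where open ≡-Reasoning

  S-% : ∀ t → S (t % N) ≡ S t
  S-% t = tabulate-cong (λ i → cong (λ r → does (N ≤? r + K)) (residue-%ˡ t (toℕ i)))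

  InS⇒∈S : ∀ t y → InS t y → y mod N ∈ S t
  InS⇒∈S t y y∈ = lookup⇒[]= (y mod N) (S t) (trans (lookup-S t y) (dec-true (N ≤? residue t y + K) y∈))

  ∈S⇒InS : ∀ t {i} → i ∈ S t → InS t (toℕ i)
  ∈S⇒InS t {i} i∈ = does≡true⇒ (N ≤? residue t (toℕ i) + K)
    (trans (sym (lookup∘tabulate (λ j → memb t (toℕ j)) i)) ([]=⇒lookup i∈))

  rotation-of-S : ∀ {X} t → IsRotation X (S t) → X ≡ S (t + K)
  rotation-of-S {X} t X→St = lookup-ext (λ i → begin
      lookup X i                            ≡⟨ X→St i ⟨
      lookup (S t) (next i)                 ≡⟨ cong (λ j → lookup (S t) (next j)) (toℕ-mod-id i) ⟨
      lookup (S t) (next (toℕ i mod N))     ≡⟨ cong (lookup (S t)) (next-mod (toℕ i)) ⟩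
      lookup (S t) (suc (toℕ i) mod N)      ≡⟨ lookup-S t (suc (toℕ i)) ⟩
      memb t (suc (toℕ i))                  ≡⟨ cong (λ x → does (N ≤? x % N + K)) (regroup (toℕ i) K t) ⟩
      memb (t + K) (toℕ i)                  ≡⟨ lookup∘tabulate (λ j → memb (t + K) (toℕ j)) i ⟨
      lookup (S (t + K)) i                  ∎)
    where open ≡-Reasoning
          regroup : ∀ x k t → suc x * k + t ≡ x * k + (t + k)
          regroup = solve-∀

  χ-S : ∀ t y → χ (S t) y ≡ bit (memb t y)
  χ-S t y = cong bit (lookup-S t y)

  module _ (K≤N : K ≤ N) where

    memb-step : ∀ t x → bit (memb t x) + (x * K + t) / N ≡ (suc x * K + t) / N
    memb-step t x = begin
      bit (memb t x) + (x * K + t) / N           ≡⟨ cong (_+ (x * K + t) / N) ([r+K]/N≡bit (m%n<n (x * K + t) N) K≤N) ⟨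
      (residue t x + K) / N + (x * K + t) / N    ≡⟨ +-comm _ ((x * K + t) / N) ⟩
      (x * K + t) / N + (residue t x + K) / N    ≡⟨ /-split (x * K + t) K ⟨
      (x * K + t + K) / N                        ≡⟨ cong (_/ N) (regroup x K t) ⟩
      (suc x * K + t) / N                        ∎
      where open ≡-Reasoning
            regroup : ∀ x k t → x * k + t + k ≡ suc x * k + t
            regroup = solve-∀

    arcCount-S : ∀ t m x → arcCount (S t) (x mod N) m ≡ (residue t x + m * K) / N
    arcCount-S t m x = +-cancelʳ-≡ ((x * K + t) / N) _ _ (begin
      arcCount (S t) (x mod N) m + (x * K + t) / N          ≡⟨ cong (_+ (x * K + t) / N) (arcCount≡∑ (S t) m x) ⟩
      ∑ m (λ j → χ (S t) (x + j)) + (x * K + t) / N         ≡⟨ cong (_+ (x * K + t) / N) (∑-cong m (λ j _ → χ-S t (x + j))) ⟩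
      ∑ m (λ j → bit (memb t (x + j))) + (x * K + t) / N    ≡⟨ ∑-telescope {λ y → bit (memb t y)} {λ y → (y * K + t) / N} (memb-step t) m x ⟩
      ((x + m) * K + t) / N                                 ≡⟨ cong (_/ N) (regroup x m K t) ⟩
      (x * K + t + m * K) / N                               ≡⟨ /-split (x * K + t) (m * K) ⟩
      (x * K + t) / N + (residue t x + m * K) / N           ≡⟨ +-comm ((x * K + t) / N) _ ⟩
      (residue t x + m * K) / N + (x * K + t) / N           ∎)
      where open ≡-Reasoning
            regroup : ∀ x m k t → (x + m) * k + t ≡ x * k + t + m * k
            regroup = solve-∀

    arcCount-S-bounds : ∀ t m (i : Fin N) → m * K / N ≤ arcCount (S t) i m × arcCount (S t) i m ≤ m * K / N + 1
    arcCount-S-bounds t m i = subst (λ c → m * K / N ≤ c × c ≤ m * K / N + 1)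
      (trans (sym (arcCount-S t m (toℕ i))) (cong (λ j → arcCount (S t) j m) (toℕ-mod-id i)))
      ([r+D]/N-bounds (m * K) (m%n<n (toℕ i * K + t) N))

    S-wellSpread : ∀ t → WellSpread (S t)
    S-wellSpread t m _ _ i j =
      ≤-trans (proj₂ (arcCount-S-bounds t m i)) (+-monoˡ-≤ 1 (proj₁ (arcCount-S-bounds t m j)))

    S-card : ∀ t → ∣ S t ∣ ≡ K
    S-card t = begin
      ∣ S t ∣                           ≡⟨ ∣∣≡∑χ (S t) ⟩
      ∑ N (χ (S t))                      ≡⟨ arcCount≡∑ (S t) N 0 ⟨
      arcCount (S t) (0 mod N) N         ≡⟨ arcCount-S t N 0 ⟩
      (residue t 0 + N * K) / N          ≡⟨ cong (λ z → (residue t 0 + z) / N) (*-comm N K) ⟩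
      (residue t 0 + K * N) / N          ≡⟨ [m+kn]/n≡m/n+k (residue t 0) K ⟩
      residue t 0 / N + K                ≡⟨ cong (_+ K) (m<n⇒m/n≡0 (m%n<n t N)) ⟩
      K                                  ∎
      where open ≡-Reasoning

    S-noConsecutive : 2 * K ≤ N ⊎ n′ ≡ 0 → ∀ t → NoConsecutive (S t)
    S-noConsecutive (inj₂ refl) t fzero _ _ = refl
    S-noConsecutive (inj₁ 2K≤N) t i i∈ next-i∈ = ⊥-elim (<⇒≱ (s≤s (s≤s z≤n)) (begin
      2                                         ≡⟨ cong₂ (λ b c → bit b + (bit c + 0)) ([]=⇒lookup i∈) ([]=⇒lookup next-i∈) ⟨
      bit (lookup (S t) i) + (bit (lookup (S t) (next i)) + 0)
                                                ≡⟨ cong (bit (lookup (S t) i) +_) (arcCount-suc (S t) (next i) 0) ⟨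
      bit (lookup (S t) i) + arcCount (S t) (next i) 1
                                                ≡⟨ arcCount-suc (S t) i 1 ⟨
      arcCount (S t) i 2                        ≡⟨ cong (λ j → arcCount (S t) j 2) (toℕ-mod-id i) ⟨
      arcCount (S t) (toℕ i mod N) 2            ≡⟨ arcCount-S t 2 (toℕ i) ⟩
      (residue t (toℕ i) + 2 * K) / N           ≤⟨ /-monoˡ-≤ N (+-monoʳ-≤ (residue t (toℕ i)) (subst (2 * K ≤_) (sym (*-identityˡ N)) 2K≤N)) ⟩
      (residue t (toℕ i) + 1 * N) / N           ≡⟨ [m+kn]/n≡m/n+k (residue t (toℕ i)) 1 ⟩
      residue t (toℕ i) / N + 1                 ≡⟨ cong (_+ 1) (m<n⇒m/n≡0 (m%n<n (toℕ i * K + t) N)) ⟩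
      1                                         ∎))
      where open ≤-Reasoning

module Disjointness (n′ K e f : ℕ) (inverse : e * K ≡ f * suc n′ + 1) where

  open StandardSets n′ K public

  residue-surjective : ∀ s {r} → r < N → Σ ℕ λ y → residue s y ≡ r
  residue-surjective s {r} r<N = e * T , %-unique {q = T * f + s / N + 1} r<N (begin
      e * T * K + s                                 ≡⟨ cong (e * T * K +_) (m≡m%n+[m/n]*n s N) ⟩
      e * T * K + (s % N + s / N * N)               ≡⟨ regroup e T K (s % N) (s / N * N) ⟩
      T * (e * K) + s % N + s / N * N               ≡⟨ cong (λ z → T * z + s % N + s / N * N) inverse ⟩
      T * (f * N + 1) + s % N + s / N * N           ≡⟨ expand r u f N (s % N) (s / N) ⟩
      r + (u + s % N) + T * f * N + s / N * N       ≡⟨ cong (λ z → r + z + T * f * N + s / N * N) (m∸n+n≡m (m%n≤n s N)) ⟩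
      r + N + T * f * N + s / N * N                 ≡⟨ collect r N (T * f) (s / N) ⟩
      r + (T * f + s / N + 1) * N                   ∎)
    where
      open ≡-Reasoning
      -- y = e (r − s) modulo N, e being an inverse of K modulo N
      u T : ℕ
      u = N ∸ s % N
      T = r + u
      regroup : ∀ e T K a b → e * T * K + (a + b) ≡ T * (e * K) + a + b
      regroup = solve-∀
      expand : ∀ r u f N a c → (r + u) * (f * N + 1) + a + c * N ≡ r + (u + a) + (r + u) * f * N + c * N
      expand = solve-∀
      collect : ∀ r N p c → r + N + p * N + c * N ≡ r + (p + c + 1) * N
      collect = solve-∀

  residue-rotate : ∀ t c y → residue (t + c) y ≡ residue t (y + c * e)
  residue-rotate t c y = sym (begin
      ((y + c * e) * K + t) % N                   ≡⟨ cong (_% N) (expand y c e K t) ⟩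
      (y * K + t + c * (e * K)) % N               ≡⟨ cong (λ z → (y * K + t + c * z) % N) inverse ⟩
      (y * K + t + c * (f * N + 1)) % N           ≡⟨ cong (_% N) (regroup y K t c f N) ⟩
      (y * K + (t + c) + c * f * N) % N           ≡⟨ [m+kn]%n≡m%n (y * K + (t + c)) (c * f) N ⟩
      (y * K + (t + c)) % N                       ∎)
    where
      open ≡-Reasoning
      expand : ∀ y c e K t → (y + c * e) * K + t ≡ y * K + t + c * (e * K)
      expand = solve-∀
      regroup : ∀ y K t c f N → y * K + t + c * (f * N + 1) ≡ y * K + (t + c) + c * f * N
      regroup = solve-∀

  ∈S-rotate : ∀ t c (i : Fin N) → i ∈ S (t + c) → (toℕ i + c * e) mod N ∈ S t
  ∈S-rotate t c i i∈ = InS⇒∈S t (toℕ i + c * e) (subst (λ r → N ≤ r + K) (residue-rotate t c (toℕ i)) (∈S⇒InS (t + c) i∈))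

  Disjoint-rotate : ∀ {t s} c → Disjoint (S t) (S s) → Disjoint (S (t + c)) (S (s + c))
  Disjoint-rotate {t} {s} c St∩Ss=∅ i i∈ i∈′ = St∩Ss=∅ _ (∈S-rotate t c i i∈) (∈S-rotate s c i i∈′)

  InS-common : ∀ {t s} y → InS t y → InS s y → ¬ Disjoint (S t) (S s)
  InS-common {t} {s} y y∈St y∈Ss St∩Ss=∅ = St∩Ss=∅ (y mod N) (InS⇒∈S t y y∈St) (InS⇒∈S s y y∈Ss)

  Far⇒Disjoint : ∀ {t s} → Far N K t s → Disjoint (S t) (S s)
  Far⇒Disjoint {t} {s} (D , refl , K≤D , D+K≤N) i i∈St i∈Ss =
    <⇒≱ (top+D-not-top (m%n<n (toℕ i * K + s) N) K≤D D+K≤N (∈S⇒InS s i∈Ss))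
        (subst (λ r → N ≤ r + K) (residue-+ s D (toℕ i)) (∈S⇒InS (s + D) i∈St))

  residue-+-< : ∀ s D y {r} → residue s y ≡ r → r + D < N → residue (s + D) y ≡ r + D
  residue-+-< s D y refl r+D<N = trans (residue-+ s D y) (m<n⇒m%n≡m r+D<N)

  ¬Disjoint-D<K : K ≤ N → ∀ s D → D < K → ¬ Disjoint (S (s + D)) (S s)
  ¬Disjoint-D<K K≤N s D D<K = InS-common y
      (subst (λ x → N ≤ x + K) (sym (residue-+-< s D y res r+D<N)) (begin
        N              ≡⟨ r+K≡N ⟨
        r + K          ≤⟨ +-monoˡ-≤ K (m≤m+n r D) ⟩
        r + D + K      ∎))
      (subst (λ x → N ≤ x + K) (sym res) (≤-reflexive (sym r+K≡N)))
    where
      open ≤-Reasoning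
      r : ℕ
      r = N ∸ K
      r+K≡N : r + K ≡ N
      r+K≡N = m∸n+n≡m K≤N
      r+D<N : r + D < N
      r+D<N = begin-strict r + D <⟨ +-monoʳ-< r D<K ⟩ r + K ≡⟨ r+K≡N ⟩ N ∎
      r<N : r < N
      r<N = subst (r <_) r+K≡N (m<m+n r (≤-<-trans z≤n D<K))
      y : ℕ
      y = proj₁ (residue-surjective s r<N)
      res : residue s y ≡ r
      res = proj₂ (residue-surjective s r<N)

  ¬Disjoint-N<D+K : 1 ≤ K → K ≤ N → ∀ s D → D < N → N < D + K → ¬ Disjoint (S (s + D)) (S s)
  ¬Disjoint-N<D+K 1≤K K≤N s zero    D<N N<K = ⊥-elim (<⇒≱ N<K K≤N)
  ¬Disjoint-N<D+K 1≤K K≤N s (suc D) D<N N<D+K = InS-common y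
      (subst (λ x → N ≤ x + K) (sym res+D) (≤-pred N<D+K))
      (subst (λ x → N ≤ x + K) (sym res) (subst (_≤ n′ + K) (+-comm n′ 1) (+-monoʳ-≤ n′ 1≤K)))
    where
      y : ℕ
      y = proj₁ (residue-surjective s ≤-refl)
      res : residue s y ≡ n′
      res = proj₂ (residue-surjective s ≤-refl)
      res+D : residue (s + suc D) y ≡ D
      res+D = begin
        residue (s + suc D) y       ≡⟨ residue-+ s (suc D) y ⟩
        (residue s y + suc D) % N   ≡⟨ cong (λ r → (r + suc D) % N) res ⟩
        (n′ + suc D) % N            ≡⟨ cong (_% N) (trans (+-comm n′ (suc D)) (sym (+-suc D n′))) ⟩
        (D + N) % N                 ≡⟨ [m+n]%n≡m%n D N ⟩
        D % N                       ≡⟨ m<n⇒m%n≡m (<-trans (n<1+n D) D<N) ⟩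
        D                           ∎
        where open ≡-Reasoning

  Disjoint⇒Far : 1 ≤ K → K ≤ N → ∀ {t s} → s ≤ t → t < N → Disjoint (S t) (S s) → Far N K t s
  Disjoint⇒Far 1≤K K≤N {t} {s} s≤t t<N St∩Ss=∅ =
      D , sym s+D≡t
    , ≮⇒≥ (λ D<K → ¬Disjoint-D<K K≤N s D D<K Ss+D∩Ss=∅)
    , ≮⇒≥ (λ N<D+K → ¬Disjoint-N<D+K 1≤K K≤N s D (≤-<-trans (m∸n≤m t s) t<N) N<D+K Ss+D∩Ss=∅)
    where
      D : ℕ
      D = t ∸ s
      s+D≡t : s + D ≡ t
      s+D≡t = m+[n∸m]≡n s≤t
      Ss+D∩Ss=∅ : Disjoint (S (s + D)) (S s)
      Ss+D∩Ss=∅ = subst (λ x → Disjoint (S x) (S s)) (sym s+D≡t) St∩Ss=∅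

  Disjoint⇒Far⊎Far : 1 ≤ K → K ≤ N → ∀ {t s} → t < N → s < N → Disjoint (S t) (S s) → Far N K t s ⊎ Far N K s t
  Disjoint⇒Far⊎Far 1≤K K≤N {t} {s} t<N s<N St∩Ss=∅ with ≤-total s t
  ... | inj₁ s≤t = inj₁ (Disjoint⇒Far 1≤K K≤N s≤t t<N St∩Ss=∅)
  ... | inj₂ t≤s = inj₂ (Disjoint⇒Far 1≤K K≤N t≤s s<N (Disjoint-sym St∩Ss=∅))

  InS-transfer : ∀ {t s} → S t ≡ S s → ∀ y → InS t y → InS s y
  InS-transfer {t} {s} St≡Ss y y∈St = subst (λ r → N ≤ r + K) (trans (cong (residue s) (toℕ-mod y)) (residue-%ʳ s y))
    (∈S⇒InS s (subst (λ X → y mod N ∈ X) St≡Ss (InS⇒∈S t y y∈St)))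

  InS-gained : K < N → ∀ s {q} → 0 < q → q ≤ K → Σ ℕ λ y → ¬ InS s y × InS (s + q) y
  InS-gained K<N s {q} 0<q q≤K = y , <⇒≱ (subst (λ x → x + K < N) (sym res) r+K<N) , y∈Ss+q
    where
      open ≤-Reasoning
      r : ℕ
      r = N ∸ suc K
      r+1+K≡N : r + suc K ≡ N
      r+1+K≡N = m∸n+n≡m K<N
      r+K<N : r + K < N
      r+K<N = begin-strict r + K <⟨ +-monoʳ-< r (n<1+n K) ⟩ r + suc K ≡⟨ r+1+K≡N ⟩ N ∎
      r<N : r < N
      r<N = ≤-<-trans (m≤m+n r K) r+K<N
      y : ℕ
      y = proj₁ (residue-surjective s r<N)
      res : residue s y ≡ r
      res = proj₂ (residue-surjective s r<N)
      y∈Ss+q : InS (s + q) y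
      y∈Ss+q = subst (λ x → N ≤ x + K) (sym (residue-+-< s q y res (begin-strict
          r + q      ≤⟨ +-monoʳ-≤ r q≤K ⟩
          r + K      <⟨ r+K<N ⟩
          N          ∎))) (begin
          N          ≡⟨ r+1+K≡N ⟨
          r + suc K  ≡⟨ +-suc r K ⟩
          suc r + K  ≤⟨ +-monoˡ-≤ K (subst (_≤ r + q) (+-comm r 1) (+-monoʳ-≤ r 0<q)) ⟩
          r + q + K  ∎)

  InS-lost : 1 ≤ K → K < N → ∀ s {q} → K ≤ q → q < N → Σ ℕ λ y → InS s y × ¬ InS (s + q) y
  InS-lost 1≤K K<N s {q} K≤q q<N = y , y∈Ss , <⇒≱ (subst (λ x → x + K < N) (sym res+q) q∸K+K<N)
    where
      open ≤-Reasoning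
      r : ℕ
      r = N ∸ K
      r+K≡N : r + K ≡ N
      r+K≡N = m∸n+n≡m (<⇒≤ K<N)
      r<N : r < N
      r<N = subst (r <_) r+K≡N (m<m+n r 1≤K)
      y : ℕ
      y = proj₁ (residue-surjective s r<N)
      res : residue s y ≡ r
      res = proj₂ (residue-surjective s r<N)
      y∈Ss : InS s y
      y∈Ss = subst (λ x → N ≤ x + K) (sym res) (≤-reflexive (sym r+K≡N))
      q∸K+K<N : q ∸ K + K < N
      q∸K+K<N = subst (_< N) (sym (m∸n+n≡m K≤q)) q<N
      res+q : residue (s + q) y ≡ q ∸ K
      res+q = begin-equality
        residue (s + q) y           ≡⟨ residue-+ s q y ⟩
        (residue s y + q) % N       ≡⟨ cong (λ x → (x + q) % N) res ⟩
        (r + q) % N                 ≡⟨ cong (λ x → (r + x) % N) (m∸n+n≡m K≤q) ⟨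
        (r + (q ∸ K + K)) % N       ≡⟨ cong (_% N) (swap r (q ∸ K) K) ⟩
        (q ∸ K + (r + K)) % N       ≡⟨ cong (λ x → (q ∸ K + x) % N) r+K≡N ⟩
        (q ∸ K + N) % N             ≡⟨ [m+n]%n≡m%n (q ∸ K) N ⟩
        (q ∸ K) % N                 ≡⟨ m<n⇒m%n≡m (≤-<-trans (m≤m+n (q ∸ K) K) q∸K+K<N) ⟩
        q ∸ K                       ∎
        where swap : ∀ a b c → a + (b + c) ≡ b + (a + c)
              swap = solve-∀

  S-shift-≢ : 1 ≤ K → K < N → ∀ s q → 0 < q → q < N → S (s + q) ≢ S s
  S-shift-≢ 1≤K K<N s q 0<q q<N Ss+q≡Ss with K ≤? q
  ... | no  K≰q = let (y , y∉Ss , y∈Ss+q) = InS-gained K<N s 0<q (<⇒≤ (≰⇒> K≰q))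
                  in y∉Ss (InS-transfer Ss+q≡Ss y y∈Ss+q)
  ... | yes K≤q = let (y , y∈Ss , y∉Ss+q) = InS-lost 1≤K K<N s K≤q q<N
                  in y∉Ss+q (InS-transfer (sym Ss+q≡Ss) y y∈Ss)

  S-injective : 1 ≤ K → K < N → ∀ {t s} → t < N → s < N → S t ≡ S s → t ≡ s
  S-injective 1≤K K<N {t} {s} t<N s<N St≡Ss with <-cmp t s
  ... | tri≈ _ t≡s _ = t≡s
  ... | tri< t<s _ _ = ⊥-elim (S-shift-≢ 1≤K K<N t (s ∸ t) (m<n⇒0<n∸m t<s) (≤-<-trans (m∸n≤m s t) s<N)
                          (trans (cong S (m+[n∸m]≡n (<⇒≤ t<s))) (sym St≡Ss)))
  ... | tri> _ _ s<t = ⊥-elim (S-shift-≢ 1≤K K<N s (t ∸ s) (m<n⇒0<n∸m s<t) (≤-<-trans (m∸n≤m t s) t<N)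
                          (trans (cong S (m+[n∸m]≡n (<⇒≤ s<t))) St≡Ss))

  S-+-injective : 1 ≤ K → K < N → ∀ {v w} c → v < N → w < N → S (v + c) ≡ S (w + c) → v ≡ w
  S-+-injective 1≤K K<N {v} {w} c v<N w<N Sv+c≡Sw+c = %-+-cancelʳ c v<N w<N
    (S-injective 1≤K K<N (m%n<n (v + c) N) (m%n<n (w + c) N) (trans (S-% (v + c)) (trans Sv+c≡Sw+c (sym (S-% (w + c))))))

-- Every well-spread K-subset of ℤ_N is some S_t

module Characterisation (n′ K e f : ℕ) (inverse : e * K ≡ f * suc n′ + 1) where

  open Disjointness n′ K e f inverse public

  module _ (K≤N : K ≤ N) (U : Subset N) (∣U∣≡K : ∣ U ∣ ≡ K) (U-wellSpread : WellSpread U) where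

    prefix : ℕ → ℕ
    prefix i = ∑ i (χ U)

    arc : ℕ → ℕ → ℕ
    arc x m = ∑ m (λ j → χ U (x + j))

    prefix-+ : ∀ x m → prefix (x + m) ≡ prefix x + arc x m
    prefix-+ x m = ∑-split x m (χ U)

    ∑-arc : ∀ m → ∑ N (λ x → arc x m) ≡ m * K
    ∑-arc m = begin
      ∑ N (λ x → arc x m)                      ≡⟨ ∑-swap N m (λ x j → χ U (x + j)) ⟩
      ∑ m (λ j → ∑ N (λ x → χ U (x + j)))      ≡⟨ ∑-cong m (λ j _ → ∑-rotate (χ-periodic U) j) ⟩
      ∑ m (λ _ → ∑ N (χ U))                    ≡⟨ cong (λ c → ∑ m (λ _ → c)) (trans (sym (∣∣≡∑χ U)) ∣U∣≡K) ⟩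
      ∑ m (λ _ → K)                            ≡⟨ ∑-const m K ⟩
      m * K                                    ∎
      where open ≡-Reasoning

    arc-full : ∀ x → arc x N ≡ K
    arc-full x = begin
      arc x N                    ≡⟨ ∑-cong N (λ j _ → cong (χ U) (+-comm x j)) ⟩
      ∑ N (λ j → χ U (j + x))    ≡⟨ ∑-rotate (χ-periodic U) x ⟩
      ∑ N (χ U)                  ≡⟨ ∣∣≡∑χ U ⟨
      ∣ U ∣                      ≡⟨ ∣U∣≡K ⟩
      K                          ∎
      where open ≡-Reasoning

    arc-spread : ∀ m → 0 < m → m < N → ∀ x z → arc x m ≤ arc z m + 1
    arc-spread m 0<m m<N x z = subst₂ (λ p q → p ≤ q + 1) (arcCount≡∑ U m x) (arcCount≡∑ U m z)
      (U-wellSpread m 0<m (subst (_≤ N) (+-comm 1 m) m<N) (x mod N) (z mod N))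

    arc-bounds : ∀ m → m ≤ N → ∀ x → N * arc x m < m * K + N × m * K < N * arc x m + N
    arc-bounds zero m≤N x = subst (_< N) (sym (*-zeroʳ N)) z<s , subst (0 <_) (cong (_+ N) (sym (*-zeroʳ N))) z<s
    arc-bounds m@(suc _) m≤N x with m≤n⇒m<n∨m≡n m≤N
    ... | inj₂ refl = subst (λ a → N * a < N * K + N × N * K < N * a + N) (sym (arc-full x))
                        (m<m+n (N * K) z<s , m<m+n (N * K) z<s)
    ... | inj₁ m<N = ≤∧≢⇒< upper upper-strict , ≤∧≢⇒< lower lower-strict
      where
        spread : ∀ x z → arc x m ≤ arc z m + 1
        spread = arc-spread m z<s m<N
        upper : N * arc x m ≤ m * K + N
        upper = subst (λ s → N * arc x m ≤ s + N) (∑-arc m) (∑-spread-upper N spread x)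
        lower : m * K ≤ N * arc x m + N
        lower = subst (_≤ N * arc x m + N) (∑-arc m) (∑-spread-lower N spread x)
        upper-strict : N * arc x m ≢ m * K + N
        upper-strict eq with arc x m
        ... | zero  = 0≢1+n (trans (sym (*-zeroʳ N)) (trans eq (+-comm (m * K) N)))
        ... | suc a = *-invertible⇒≢ {N} {K} {e} {f} inverse m z<s m<N a (sym (+-cancelʳ-≡ N _ _ (trans (swap a N) eq)))
          where swap : ∀ a n → a * n + n ≡ n * suc a
                swap = solve-∀
        lower-strict : m * K ≢ N * arc x m + N
        lower-strict eq = *-invertible⇒≢ {N} {K} {e} {f} inverse m z<s m<N (arc x m + 1) (trans eq (swap N (arc x m)))
          where swap : ∀ n a → n * a + n ≡ (a + 1) * n
                swap = solve-∀

    prefix-gap : ∀ i j → i ≤ N → j ≤ N → i * K + prefix j * N < prefix i * N + j * K + N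
    prefix-gap i j i≤N j≤N with ≤-total j i
    ... | inj₁ j≤i = subst (λ i → i * K + prefix j * N < prefix i * N + j * K + N) (m+[n∸m]≡n j≤i)
                       (ascending j (i ∸ j) (≤-trans (m∸n≤m i j) i≤N))
      where
        ascending : ∀ j m → m ≤ N → (j + m) * K + prefix j * N < prefix (j + m) * N + j * K + N
        ascending j m m≤N = begin-strict
          (j + m) * K + prefix j * N                  ≡⟨ regroup j m K (prefix j * N) ⟩
          (j * K + prefix j * N) + m * K              <⟨ +-monoʳ-< _ (subst (λ a → m * K < a + N) (*-comm N (arc j m)) (proj₂ (arc-bounds m m≤N j))) ⟩
          (j * K + prefix j * N) + (arc j m * N + N)  ≡⟨ collect j K (prefix j) (arc j m) N ⟩
          (prefix j + arc j m) * N + j * K + N        ≡⟨ cong (λ c → c * N + j * K + N) (prefix-+ j m) ⟨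
          prefix (j + m) * N + j * K + N              ∎
          where open ≤-Reasoning
                regroup : ∀ j m k x → (j + m) * k + x ≡ (j * k + x) + m * k
                regroup = solve-∀
                collect : ∀ j k c a n → (j * k + c * n) + (a * n + n) ≡ (c + a) * n + j * k + n
                collect = solve-∀
    ... | inj₂ i≤j = subst (λ j → i * K + prefix j * N < prefix i * N + j * K + N) (m+[n∸m]≡n i≤j)
                       (descending i (j ∸ i) (≤-trans (m∸n≤m j i) j≤N))
      where
        descending : ∀ i m → m ≤ N → i * K + prefix (i + m) * N < prefix i * N + (i + m) * K + N
        descending i m m≤N = begin-strict
          i * K + prefix (i + m) * N                  ≡⟨ cong (λ c → i * K + c * N) (prefix-+ i m) ⟩
          i * K + (prefix i + arc i m) * N            ≡⟨ regroup i K (prefix i) (arc i m) N ⟩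
          (i * K + prefix i * N) + arc i m * N        <⟨ +-monoʳ-< _ (subst (_< m * K + N) (*-comm N (arc i m)) (proj₁ (arc-bounds m m≤N i))) ⟩
          (i * K + prefix i * N) + (m * K + N)        ≡⟨ collect i K (prefix i) N m ⟩
          prefix i * N + (i + m) * K + N              ∎
          where open ≤-Reasoning
                regroup : ∀ i k c a n → i * k + (c + a) * n ≡ (i * k + c * n) + a * n
                regroup = solve-∀
                collect : ∀ i k c n m → (i * k + c * n) + (m * k + n) ≡ c * n + (i + m) * k + n
                collect = solve-∀

    excess : ℕ → ℕ
    excess i = prefix i * N ∸ i * K

    phase : ℕ
    phase = max< excess (suc N)

    prefix-lower : ∀ i → i ≤ N → prefix i * N ≤ i * K + phase
    prefix-lower i i≤N = ≤-trans (m≤n+m∸n (prefix i * N) (i * K)) (+-monoʳ-≤ (i * K) (≤-max< excess (suc N) (s≤s i≤N)))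

    prefix-upper : ∀ i → i ≤ N → i * K + phase < prefix i * N + N
    prefix-upper i i≤N = max<-attained excess (suc N) (λ t → i * K + t < prefix i * N + N)
      (below z≤n) (λ j<1+N → below (≤-pred j<1+N))
      where
        below : ∀ {j} → j ≤ N → i * K + excess j < prefix i * N + N
        below {j} j≤N with ≤-total (prefix j * N) (j * K)
        ... | inj₁ cN≤jK = subst₂ _<_ (cong (i * K +_) (sym (m≤n⇒m∸n≡0 cN≤jK))) (cong (_+ N) (+-identityʳ (prefix i * N)))
                             (prefix-gap i 0 i≤N z≤n)
        ... | inj₂ jK≤cN = +-cancelʳ-< (j * K) _ _ (begin-strict
          i * K + excess j + j * K          ≡⟨ +-assoc (i * K) (excess j) (j * K) ⟩
          i * K + (excess j + j * K)        ≡⟨ cong (i * K +_) (m∸n+n≡m jK≤cN) ⟩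
          i * K + prefix j * N              <⟨ prefix-gap i j i≤N j≤N ⟩
          prefix i * N + j * K + N          ≡⟨ swap (prefix i * N) (j * K) N ⟩
          prefix i * N + N + j * K          ∎)
          where open ≤-Reasoning
                swap : ∀ a b c → a + b + c ≡ a + c + b
                swap = solve-∀

    phase<N : phase < N
    phase<N = prefix-upper 0 z≤n

    prefix≡ : ∀ i → i ≤ N → prefix i ≡ (i * K + phase) / N
    prefix≡ i i≤N = sym (/-unique (prefix-lower i i≤N) (prefix-upper i i≤N))

    χ≡memb : ∀ x → x < N → χ U x ≡ bit (memb phase x)
    χ≡memb x x<N = +-cancelʳ-≡ (prefix x) _ _ (begin
      χ U x + prefix x                              ≡⟨ +-comm (χ U x) (prefix x) ⟩
      prefix x + χ U x                              ≡⟨ ∑-snoc x (χ U) ⟨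
      prefix (suc x)                                ≡⟨ prefix≡ (suc x) x<N ⟩
      (suc x * K + phase) / N                       ≡⟨ memb-step K≤N phase x ⟨
      bit (memb phase x) + (x * K + phase) / N      ≡⟨ cong (bit (memb phase x) +_) (prefix≡ x (<⇒≤ x<N)) ⟨
      bit (memb phase x) + prefix x                 ∎)
      where open ≡-Reasoning

    U≡S : U ≡ S phase
    U≡S = lookup-ext (λ i → bit-injective (begin
      bit (lookup U i)                       ≡⟨ cong (λ j → bit (lookup U j)) (toℕ-mod-id i) ⟨
      χ U (toℕ i)                            ≡⟨ χ≡memb (toℕ i) (toℕ<n i) ⟩
      bit (memb phase (toℕ i))               ≡⟨ cong bit (lookup∘tabulate (λ j → memb phase (toℕ j)) i) ⟨
      bit (lookup (S phase) i)               ∎))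
      where open ≡-Reasoning

-- The maps T ↦ ⌊T a/n⌋ and x ↦ ⌈x n/a⌉

module Parameters (n′ a′ k b : ℕ) (ak+1≡bn : suc a′ * k + 1 ≡ b * suc n′) where

  n a : ℕ
  n = suc n′
  a = suc a′

  bn≡ka+1 : b * n ≡ k * a + 1
  bn≡ka+1 = trans (sym ak+1≡bn) (cong (_+ 1) (*-comm a k))

  φ : ℕ → ℕ
  φ T = T * a / n

  -- ψ x = ⌈x n / a⌉
  ψ : ℕ → ℕ
  ψ x = (x * n + a′) / a

  φ-+n : ∀ S → φ (S + n) ≡ φ S + a
  φ-+n S = trans (cong (_/ n) (trans (*-distribʳ-+ a S n) (cong (S * a +_) (*-comm n a)))) ([m+kn]/n≡m/n+k (S * a) a)

  ψ-+a : ∀ W → ψ (W + a) ≡ ψ W + n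
  ψ-+a W = trans (cong (_/ a) (regroup W n a′)) ([m+kn]/n≡m/n+k (W * n + a′) n)
    where regroup : ∀ w n c → (w + suc c) * n + c ≡ w * n + c + n * suc c
          regroup = solve-∀

  φ-gap : ∀ {T S} → Far n k T S → 0 < (S * a) % n ⊎ S + k < T → φ S + b ≤ φ T
  φ-gap {S = S} (D , refl , k≤D , _) exception = subst (φ S + b ≤_) (cong (_/ n) (sym (*-distribʳ-+ a S D)))
    (/-gap (S * a) (D * a) b (subst (_≤ (S * a) % n + D * a) (sym bn≡ka+1) (ka+1≤ exception)))
    where
      ka+1≤ : 0 < (S * a) % n ⊎ S + k < S + D → k * a + 1 ≤ (S * a) % n + D * a
      ka+1≤ (inj₁ 0<r)   = subst (_≤ (S * a) % n + D * a) (+-comm 1 (k * a)) (+-mono-≤ 0<r (*-monoˡ-≤ a k≤D))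
      ka+1≤ (inj₂ S+k<S+D) = ≤-trans (+-monoʳ-≤ (k * a) (s≤s z≤n)) (≤-trans (≤-reflexive (+-comm (k * a) a))
                               (≤-trans (*-monoˡ-≤ a (+-cancelˡ-< S k D S+k<S+D)) (m≤n+m (D * a) _)))

  ψ-gap : ∀ {U W} → Far a b U W → ψ W + k ≤ ψ U
  ψ-gap {W = W} (D , refl , b≤D , _) = subst (ψ W + k ≤_) (cong (_/ a) (regroup W D n a′))
    (/-gap (W * n + a′) (D * n) k (≤-trans (m≤m+n (k * a) 1) (≤-trans (≤-reflexive (sym bn≡ka+1))
      (≤-trans (*-monoˡ-≤ n b≤D) (m≤n+m (D * n) _)))))
    where regroup : ∀ w d n c → w * n + c + d * n ≡ (w + d) * n + c
          regroup = solve-∀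

  inverse-mod-n : 1 ≤ n′ → 1 ≤ b → n′ * (k * a) ≡ pred (n′ * b) * n + 1
  inverse-mod-n 1≤n′ 1≤b = +-cancelʳ-≡ n′ _ _ (begin
      n′ * (k * a) + n′             ≡⟨ distribute n′ (k * a) ⟩
      n′ * (k * a + 1)              ≡⟨ cong (n′ *_) bn≡ka+1 ⟨
      n′ * (b * n)                  ≡⟨ *-assoc n′ b n ⟨
      n′ * b * n                    ≡⟨ cong (_* n) (suc-pred (n′ * b) ⦃ >-nonZero (*-mono-≤ 1≤n′ 1≤b) ⦄) ⟨
      suc (pred (n′ * b)) * n       ≡⟨ expand (pred (n′ * b)) n′ ⟩
      pred (n′ * b) * n + 1 + n′    ∎)
    where
      open ≡-Reasoning
      distribute : ∀ x y → x * y + x ≡ x * (y + 1)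
      distribute = solve-∀
      expand : ∀ p m → suc p * suc m ≡ p * suc m + 1 + m
      expand = solve-∀

  [S*a]%n>0 : 1 ≤ n′ → 1 ≤ b → ∀ {S} → 0 < S → S < n → 0 < (S * a) % n
  [S*a]%n>0 1≤n′ 1≤b {S} 0<S S<n = n≢0⇒n>0 (λ r≡0 → *-invertible⇒≢ {e = n′ * k} {f = pred (n′ * b)}
    (trans (*-assoc n′ k a) (inverse-mod-n 1≤n′ 1≤b)) S 0<S S<n ((S * a) / n)
    (trans (m≡m%n+[m/n]*n (S * a) n) (cong (_+ (S * a) / n * n) r≡0)))

  φ-Far : 1 ≤ k → 1 ≤ n′ → 1 ≤ b → ∀ {T S} → T < n → Far n k T S → ¬ (T ≡ k × S ≡ 0) → Far a b (φ T) (φ S)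
  φ-Far 1≤k 1≤n′ 1≤b {T} {S} T<n far not-edge = Far-intro (φ-gap far lower-exception)
    (subst (φ T + b ≤_) (φ-+n S) (φ-gap (Far-complement far) upper-exception))
    where
      S+k≤T : S + k ≤ T
      S+k≤T = Far⇒+≤ far
      lower-exception : 0 < (S * a) % n ⊎ S + k < T
      lower-exception with S ≟ 0
      ... | yes S≡0 = inj₂ (≤∧≢⇒< S+k≤T (λ S+k≡T → not-edge (trans (sym S+k≡T) (cong (_+ k) S≡0) , S≡0)))
      ... | no  S≢0 = inj₁ ([S*a]%n>0 1≤n′ 1≤b (n≢0⇒n>0 S≢0) (≤-<-trans (≤-trans (m≤m+n S k) S+k≤T) T<n))
      upper-exception : 0 < (T * a) % n ⊎ T + k < S + n
      upper-exception = inj₁ ([S*a]%n>0 1≤n′ 1≤b (≤-trans 1≤k (≤-trans (m≤n+m k S) S+k≤T)) T<n)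

  ψ-Far : ∀ {U W} → Far a b U W → Far n k (ψ U) (ψ W)
  ψ-Far {U} {W} far = Far-intro (ψ-gap far) (subst (ψ U + k ≤_) (ψ-+a W) (ψ-gap (Far-complement far)))

  ψ-bounds : a ≤ n → ∀ {U} → b ≤ U → U < a → k < ψ U × ψ U < n
  ψ-bounds a≤n {U} b≤U U<a = ≤-/ lower , m<n*o⇒m/o<n upper
    where
      open ≤-Reasoning
      lower : suc k * a ≤ U * n + a′
      lower = begin
        suc k * a        ≡⟨ regroup k a′ ⟩
        k * a + 1 + a′   ≡⟨ cong (_+ a′) bn≡ka+1 ⟨
        b * n + a′       ≤⟨ +-monoˡ-≤ a′ (*-monoˡ-≤ n b≤U) ⟩
        U * n + a′       ∎
        where regroup : ∀ k c → suc k * suc c ≡ k * suc c + 1 + c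
              regroup = solve-∀
      upper : U * n + a′ < n * a
      upper = begin-strict
        U * n + a′       ≤⟨ +-monoˡ-≤ a′ (*-monoˡ-≤ n (≤-pred U<a)) ⟩
        a′ * n + a′      <⟨ +-monoʳ-< (a′ * n) a≤n ⟩
        a′ * n + n       ≡⟨ regroup a′ n ⟩
        n * a            ∎
        where regroup : ∀ c n → c * n + n ≡ n * suc c
              regroup = solve-∀

  module Minimal (1≤k : 1 ≤ k) (2k≤n : 2 * k ≤ n) (1≤b : 1 ≤ b)
    (minimal : ∀ a₂ b₂ → 1 ≤ a₂ → 1 ≤ b₂ → a₂ * k + 1 ≡ b₂ * n → a ≤ a₂ × b ≤ b₂) where

    k<n : k < n
    k<n = begin-strict
      k          <⟨ m<m+n k 1≤k ⟩
      k + k      ≡⟨ cong (k +_) (+-identityʳ k) ⟨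
      2 * k      ≤⟨ 2k≤n ⟩
      n          ∎
      where open ≤-Reasoning

    1≤n′ : 1 ≤ n′
    1≤n′ = ≤-pred (≤-trans (s≤s 1≤k) k<n)

    2bk≤bn : 2 * b * k ≤ b * n
    2bk≤bn = begin
      2 * b * k       ≡⟨ swap b k ⟩
      b * (2 * k)     ≤⟨ *-monoʳ-≤ b 2k≤n ⟩
      b * n           ∎
      where open ≤-Reasoning
            swap : ∀ b k → 2 * b * k ≡ b * (2 * k)
            swap = solve-∀

    2b≤a+1 : 2 * b ≤ a + 1
    2b≤a+1 = *-cancelʳ-≤ (2 * b) (a + 1) k ⦃ >-nonZero 1≤k ⦄ (begin
      2 * b * k       ≤⟨ 2bk≤bn ⟩
      b * n           ≡⟨ bn≡ka+1 ⟩
      k * a + 1       ≤⟨ +-monoʳ-≤ (k * a) 1≤k ⟩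
      k * a + k       ≡⟨ collect k a ⟩
      (a + 1) * k     ∎)
      where open ≤-Reasoning
            collect : ∀ k a → k * a + k ≡ (a + 1) * k
            collect = solve-∀

    b≤a : b ≤ a
    b≤a = +-cancelʳ-≤ b b a (begin
      b + b        ≡⟨ cong (b +_) (+-identityʳ b) ⟨
      2 * b        ≤⟨ 2b≤a+1 ⟩
      a + 1        ≤⟨ +-monoʳ-≤ a 1≤b ⟩
      a + b        ∎)
      where open ≤-Reasoning

    2b≤a⊎a≡1 : 2 * b ≤ a ⊎ a′ ≡ 0
    2b≤a⊎a≡1 with 2 * b ≤? a
    ... | yes 2b≤a = inj₁ 2b≤a
    ... | no  2b≰a = inj₂ (n≤0⇒n≡0 (≤-pred (proj₁ (minimal 1 1 ≤-refl ≤-refl 1k+1≡1n))))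
      where
        open ≤-Reasoning
        2b≡a+1 : 2 * b ≡ a + 1
        2b≡a+1 = ≤-antisym 2b≤a+1 (subst (_≤ 2 * b) (+-comm 1 a) (≰⇒> 2b≰a))
        k≡1 : k ≡ 1
        k≡1 = ≤-antisym (+-cancelˡ-≤ (k * a) k 1 (begin
          k * a + k       ≡⟨ collect k a ⟩
          (a + 1) * k     ≡⟨ cong (_* k) 2b≡a+1 ⟨
          2 * b * k       ≤⟨ 2bk≤bn ⟩
          b * n           ≡⟨ bn≡ka+1 ⟩
          k * a + 1       ∎)) 1≤k
          where collect : ∀ k a → k * a + k ≡ (a + 1) * k
                collect = solve-∀
        n≡2 : n ≡ 2
        n≡2 = *-cancelˡ-≡ n 2 b ⦃ >-nonZero 1≤b ⦄ (begin-equality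
          b * n           ≡⟨ bn≡ka+1 ⟩
          k * a + 1       ≡⟨ cong (λ x → x * a + 1) k≡1 ⟩
          1 * a + 1       ≡⟨ cong (_+ 1) (*-identityˡ a) ⟩
          a + 1           ≡⟨ 2b≡a+1 ⟨
          2 * b           ≡⟨ *-comm 2 b ⟩
          b * 2           ∎)
        1k+1≡1n : 1 * k + 1 ≡ 1 * n
        1k+1≡1n = trans (cong (λ x → 1 * x + 1) k≡1) (cong (1 *_) (sym n≡2))

    a≤n : a ≤ n
    a≤n = ≮⇒≥ (λ n<a → <⇒≱ (s≤s (m∸n≤m a′ n′)) (proj₁ (minimal (a ∸ n) (b ∸ k)
            (m<n⇒0<n∸m n<a) (m<n⇒0<n∸m (k<b n<a)) (smaller-solution n<a))))
      where
        open ≤-Reasoning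
        k<b : n < a → k < b
        k<b n<a = *-cancelʳ-< n k b (begin-strict
          k * n           ≤⟨ *-monoʳ-≤ k (<⇒≤ n<a) ⟩
          k * a           <⟨ m<m+n (k * a) z<s ⟩
          k * a + 1       ≡⟨ bn≡ka+1 ⟨
          b * n           ∎)
        smaller-solution : n < a → (a ∸ n) * k + 1 ≡ (b ∸ k) * n
        smaller-solution n<a = +-cancelˡ-≡ (n * k) _ _ (begin-equality
          n * k + ((a ∸ n) * k + 1)       ≡⟨ regroup n (a ∸ n) k ⟩
          (n + (a ∸ n)) * k + 1           ≡⟨ cong (λ x → x * k + 1) (m+[n∸m]≡n (<⇒≤ n<a)) ⟩
          a * k + 1                       ≡⟨ ak+1≡bn ⟩
          b * n                           ≡⟨ cong (_* n) (m+[n∸m]≡n (<⇒≤ (k<b n<a))) ⟨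
          (k + (b ∸ k)) * n               ≡⟨ distribute k (b ∸ k) n ⟩
          n * k + (b ∸ k) * n             ∎)
          where regroup : ∀ n c k → n * k + (c * k + 1) ≡ (n + c) * k + 1
                regroup = solve-∀
                distribute : ∀ k c n → (k + c) * n ≡ n * k + c * n
                distribute = solve-∀

-- The homomorphisms

Hom-∘ : ∀ {G H K} → Hom H K → Hom G H → Hom G K
Hom-∘ (g , g-adj) (f , f-adj) = g ∘ f , λ u v uv → g-adj (f u) (f v) (f-adj u v uv)

QMinusEdge-swap : ∀ {n k} (X Y : QVertex n k) → Hom (QMinusEdge n k X Y) (QMinusEdge n k Y X)
QMinusEdge-swap X Y = id , λ U W (U∩W=∅ , not-XY) → U∩W=∅ , not-XY ∘ ⊎-swap

HomEquivalent-QMinusEdge-swap : ∀ {n k} (X Y : QVertex n k) (H : Graph) →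
  HomEquivalent (QMinusEdge n k X Y) H → HomEquivalent (QMinusEdge n k Y X) H
HomEquivalent-QMinusEdge-swap {n} {k} X Y H (to , from) =
    Hom-∘ {QMinusEdge n k Y X} {QMinusEdge n k X Y} {H} to (QMinusEdge-swap Y X)
  , Hom-∘ {H} {QMinusEdge n k X Y} {QMinusEdge n k Y X} (QMinusEdge-swap X Y) from

module Construction (n′ a′ k b : ℕ) (ak+1≡bn : suc a′ * k + 1 ≡ b * suc n′)
  (1≤k : 1 ≤ k) (2k≤n : 2 * k ≤ suc n′) (1≤b : 1 ≤ b)
  (minimal : ∀ a₂ b₂ → 1 ≤ a₂ → 1 ≤ b₂ → a₂ * k + 1 ≡ b₂ * suc n′ → suc a′ ≤ a₂ × b ≤ b₂) where

  open Parameters n′ a′ k b ak+1≡bn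
  open Minimal 1≤k 2k≤n 1≤b minimal

  module QN = Characterisation n′ k (n′ * a) (pred (n′ * b))
    (trans (*-assoc n′ a k) (trans (cong (n′ *_) (*-comm a k)) (inverse-mod-n 1≤n′ 1≤b)))
  module QA = Characterisation a′ b n k (trans (*-comm n b) bn≡ka+1)

  k≤n : k ≤ n
  k≤n = <⇒≤ k<n

  vertexN : ℕ → QVertex n k
  vertexN t = QN.S t , QN.S-card k≤n t , QN.S-noConsecutive k≤n (inj₁ 2k≤n) t , QN.S-wellSpread k≤n t

  vertexA : ℕ → QVertex a b
  vertexA t = QA.S t , QA.S-card b≤a t , QA.S-noConsecutive b≤a 2b≤a⊎a≡1 t , QA.S-wellSpread b≤a t

  phaseN : QVertex n k → ℕ
  phaseN (U , ∣U∣≡k , _ , U-ws) = QN.phase k≤n U ∣U∣≡k U-ws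

  phaseN<n : ∀ U → phaseN U < n
  phaseN<n (U , ∣U∣≡k , _ , U-ws) = QN.phase<N k≤n U ∣U∣≡k U-ws

  ≡S-phaseN : ∀ U → proj₁ U ≡ QN.S (phaseN U)
  ≡S-phaseN (U , ∣U∣≡k , _ , U-ws) = QN.U≡S k≤n U ∣U∣≡k U-ws

  phaseA : QVertex a b → ℕ
  phaseA (U , ∣U∣≡b , _ , U-ws) = QA.phase b≤a U ∣U∣≡b U-ws

  phaseA<a : ∀ U → phaseA U < a
  phaseA<a (U , ∣U∣≡b , _ , U-ws) = QA.phase<N b≤a U ∣U∣≡b U-ws

  ≡S-phaseA : ∀ U → proj₁ U ≡ QA.S (phaseA U)
  ≡S-phaseA (U , ∣U∣≡b , _ , U-ws) = QA.U≡S b≤a U ∣U∣≡b U-ws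

  module Edge (A₀ B₀ : QVertex n k) (A₀→B₀ : IsRotation (proj₁ A₀) (proj₁ B₀)) where

    t₀ : ℕ
    t₀ = phaseN B₀

    B₀≡S : proj₁ B₀ ≡ QN.S t₀
    B₀≡S = ≡S-phaseN B₀

    A₀≡S : proj₁ A₀ ≡ QN.S (t₀ + k)
    A₀≡S = QN.rotation-of-S t₀ (subst (IsRotation (proj₁ A₀)) B₀≡S A₀→B₀)

    offset : QVertex n k → ℕ
    offset U = (phaseN U + (n ∸ t₀)) % n

    offset<n : ∀ U → offset U < n
    offset<n U = m%n<n (phaseN U + (n ∸ t₀)) n

    offset≡⇒≡S : ∀ U {t} → t < n → offset U ≡ (t + (n ∸ t₀)) % n → proj₁ U ≡ QN.S t
    offset≡⇒≡S U t<n eq = trans (≡S-phaseN U) (cong QN.S (%-+-cancelʳ (n ∸ t₀) (phaseN<n U) t<n eq))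

    offset≡0⇒B₀ : ∀ U → offset U ≡ 0 → proj₁ U ≡ proj₁ B₀
    offset≡0⇒B₀ U eq = trans (offset≡⇒≡S U (phaseN<n B₀) (trans eq (sym t₀+[n∸t₀]%n≡0))) (sym B₀≡S)
      where
        t₀+[n∸t₀]%n≡0 : (t₀ + (n ∸ t₀)) % n ≡ 0
        t₀+[n∸t₀]%n≡0 = trans (cong (_% n) (m+[n∸m]≡n (<⇒≤ (phaseN<n B₀)))) (n%n≡0 n)

    offset≡k⇒A₀ : ∀ U → offset U ≡ k → proj₁ U ≡ proj₁ A₀
    offset≡k⇒A₀ U eq = begin
        proj₁ U                      ≡⟨ offset≡⇒≡S U (m%n<n (t₀ + k) n) (trans eq (sym [t₀+k]%n+[n∸t₀]%n≡k)) ⟩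
        QN.S ((t₀ + k) % n)          ≡⟨ QN.S-% (t₀ + k) ⟩
        QN.S (t₀ + k)                ≡⟨ A₀≡S ⟨
        proj₁ A₀                     ∎
      where
        open ≡-Reasoning
        [t₀+k]%n+[n∸t₀]%n≡k : ((t₀ + k) % n + (n ∸ t₀)) % n ≡ k
        [t₀+k]%n+[n∸t₀]%n≡k = begin
          ((t₀ + k) % n + (n ∸ t₀)) % n     ≡⟨ %-+-absorbˡ (t₀ + k) (n ∸ t₀) ⟩
          (t₀ + k + (n ∸ t₀)) % n           ≡⟨ cong (_% n) (trans (+-assoc t₀ k _) (trans (cong (t₀ +_) (+-comm k _)) (sym (+-assoc t₀ _ k)))) ⟩
          (t₀ + (n ∸ t₀) + k) % n           ≡⟨ cong (λ x → (x + k) % n) (m+[n∸m]≡n (<⇒≤ (phaseN<n B₀))) ⟩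
          (n + k) % n                       ≡⟨ cong (_% n) (+-comm n k) ⟩
          (k + n) % n                       ≡⟨ [m+n]%n≡m%n k n ⟩
          k % n                             ≡⟨ m<n⇒m%n≡m k<n ⟩
          k                                 ∎

    Disjoint-offset : ∀ U W → Disjoint (proj₁ U) (proj₁ W) → Disjoint (QN.S (offset U)) (QN.S (offset W))
    Disjoint-offset U W U∩W=∅ = subst₂ Disjoint (sym (QN.S-% _)) (sym (QN.S-% _))
      (QN.Disjoint-rotate (n ∸ t₀) (subst₂ Disjoint (≡S-phaseN U) (≡S-phaseN W) U∩W=∅))

    toQab : Hom (QMinusEdge n k A₀ B₀) (Q a b)
    toQab = (λ U → vertexA (φ (offset U))) , adj
      where
        adj : ∀ U W → Adj (QMinusEdge n k A₀ B₀) U W → Disjoint (QA.S (φ (offset U))) (QA.S (φ (offset W)))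
        adj U W (U∩W=∅ , not-edge)
          with QN.Disjoint⇒Far⊎Far 1≤k k≤n (offset<n U) (offset<n W) (Disjoint-offset U W U∩W=∅)
        ... | inj₁ far = QA.Far⇒Disjoint (φ-Far 1≤k 1≤n′ 1≤b (offset<n U) far
                           (λ (≡k , ≡0) → not-edge (inj₁ (offset≡k⇒A₀ U ≡k , offset≡0⇒B₀ W ≡0))))
        ... | inj₂ far = Disjoint-sym (QA.Far⇒Disjoint (φ-Far 1≤k 1≤n′ 1≤b (offset<n W) far
                           (λ (≡k , ≡0) → not-edge (inj₂ (offset≡0⇒B₀ U ≡0 , offset≡k⇒A₀ W ≡k)))))

    S-+t₀-avoids-edge : ∀ {v} → k < v → v < n → QN.S (v + t₀) ≢ proj₁ A₀ × QN.S (v + t₀) ≢ proj₁ B₀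
    S-+t₀-avoids-edge {v} k<v v<n =
        (λ ≡A₀ → <⇒≢ k<v (sym (QN.S-+-injective 1≤k k<n t₀ v<n k<n (trans ≡A₀ (trans A₀≡S (cong QN.S (+-comm t₀ k)))))))
      , (λ ≡B₀ → <⇒≢ (≤-<-trans z≤n k<v) (sym (QN.S-+-injective 1≤k k<n t₀ v<n z<s (trans ≡B₀ B₀≡S))))

    fromQab : Hom (Q a b) (QMinusEdge n k A₀ B₀)
    fromQab = (λ u → vertexN (ψ (phaseA u) + t₀)) , adj
      where
        adj : ∀ u w → Disjoint (proj₁ u) (proj₁ w) → Adj (QMinusEdge n k A₀ B₀) (vertexN (ψ (phaseA u) + t₀)) (vertexN (ψ (phaseA w) + t₀))
        adj u w u∩w=∅ with QA.Disjoint⇒Far⊎Far 1≤b b≤a (phaseA<a u) (phaseA<a w)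
                             (subst₂ Disjoint (≡S-phaseA u) (≡S-phaseA w) u∩w=∅)
        ... | inj₁ far = QN.Disjoint-rotate t₀ (QN.Far⇒Disjoint (ψ-Far far))
                       , λ { (inj₁ (≡A₀ , _)) → proj₁ avoids ≡A₀ ; (inj₂ (≡B₀ , _)) → proj₂ avoids ≡B₀ }
          where avoids : QN.S (ψ (phaseA u) + t₀) ≢ proj₁ A₀ × QN.S (ψ (phaseA u) + t₀) ≢ proj₁ B₀
                avoids = uncurry S-+t₀-avoids-edge (ψ-bounds a≤n (≤-trans (m≤n+m b _) (Far⇒+≤ far)) (phaseA<a u))
        ... | inj₂ far = Disjoint-sym (QN.Disjoint-rotate t₀ (QN.Far⇒Disjoint (ψ-Far far)))
                       , λ { (inj₁ (_ , ≡B₀)) → proj₂ avoids ≡B₀ ; (inj₂ (_ , ≡A₀)) → proj₁ avoids ≡A₀ }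
          where avoids : QN.S (ψ (phaseA w) + t₀) ≢ proj₁ A₀ × QN.S (ψ (phaseA w) + t₀) ≢ proj₁ B₀
                avoids = uncurry S-+t₀-avoids-edge (ψ-bounds a≤n (≤-trans (m≤n+m b _) (Far⇒+≤ far)) (phaseA<a w))

    homEquivalent : HomEquivalent (QMinusEdge n k A₀ B₀) (Q a b)
    homEquivalent = toQab , fromQab

proposition28 : ∀ (n k : ℕ) → 1 ≤ k → 2 * k ≤ n → gcd n k ≡ 1 →
    ∀ (a b : ℕ) → 1 ≤ a → 1 ≤ b → a * k + 1 ≡ b * n →
    (∀ (a′ b′ : ℕ) → 1 ≤ a′ → 1 ≤ b′ → a′ * k + 1 ≡ b′ * n → a ≤ a′ × b ≤ b′) →
    ∀ (X Y : QVertex n k) → IsCycleEdge X Y →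
    HomEquivalent (QMinusEdge n k X Y) (Q a b)
proposition28 zero (suc k) _ () _ _ _ _ _ _ _ _ _ _
proposition28 (suc n′) k 1≤k 2k≤n _ (suc a′) b _ 1≤b ak+1≡bn minimal X Y (_ , inj₁ X→Y) =
  C.Edge.homEquivalent X Y X→Y
  where module C = Construction n′ a′ k b ak+1≡bn 1≤k 2k≤n 1≤b minimal
proposition28 (suc n′) k 1≤k 2k≤n _ (suc a′) b _ 1≤b ak+1≡bn minimal X Y (_ , inj₂ Y→X) =
  HomEquivalent-QMinusEdge-swap Y X (Q (suc a′) b) (C.Edge.homEquivalent Y X Y→X)
  where module C = Construction n′ a′ k b ak+1≡bn 1≤k 2k≤n 1≤b minimal
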